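{- For every $n\ge1$ there is a bijection $f$ from the set $\mathcal{R}_n$ of restricted ascent sequences of length $n$ to the set of ascent sequences of length $n$ avoiding the pattern $021$ such that $\operatorname{asc}(f(\mathbf{x}))=\operatorname{asc}(\mathbf{x})$ for all $\mathbf{x}\in\mathcal{R}_n$. Consequently, the number of ascent sequences of length $n$ avoiding $021$ is the Catalan number $C_n=\frac{1}{n+1}\binom{2n}{n}$.
   Context: An ascent sequence is a finite sequence $x_1x_2\ldots x_n$ of nonnegative integers with $x_1=0$ and $x_i\le \operatorname{asc}(x_1\ldots x_{i-1})+1$ for all $1<i\le n$, where $\operatorname{asc}(y_1\ldots y_k)$ is the number of indices $j$ with $y_j<y_{j+1}$. A sequence avoids $021$ if there are no indices $i_1<i_2<i_3$ with $x_{i_1}<x_{i_3}<x_{i_2}$. A restricted ascent sequence is an ascent sequence $x_1\ldots x_n$ with $x_i\ge m_i-1$ for all $2\le i\le n$, where $m_i=\max(x_1,\ldots,x_{i-1})$. -}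

module Defs where

open import Data.Nat using (ℕ; zero; suc; _+_; _*_; _∸_; _≤_; _<_; _⊔_; _<ᵇ_; _/_)
open import Data.Nat.Combinatorics using (_C_)
open import Data.Bool using (if_then_else_)
open import Data.List using (List; []; _∷_; length; lookup; take; foldr)
open import Data.Fin using (Fin; toℕ)
open import Data.Product using (_×_)
open import Relation.Nullary using (¬_)
open import Relation.Binary.PropositionalEquality using (_≡_)

asc : List ℕ → ℕ
asc [] = 0
asc (x ∷ []) = 0
asc (x ∷ y ∷ ys) = (if x <ᵇ y then 1 else 0) + asc (y ∷ ys)

-- maximum of a list (0 for the empty list; only used on nonempty prefixes)
maxL : List ℕ → ℕ
maxL = foldr _⊔_ 0

-- Positions are 0-based: Fin index i corresponds to the paper's x_{i+1};
-- the prefix x_1 … x_{i} of the paper (before position i+1) is take (toℕ i) xs.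
IsAscentSeq : List ℕ → Set
IsAscentSeq xs =
  ((i : Fin (length xs)) → toℕ i ≡ 0 → lookup xs i ≡ 0) ×
  ((i : Fin (length xs)) → 1 ≤ toℕ i → lookup xs i ≤ suc (asc (take (toℕ i) xs)))

Avoids021 : List ℕ → Set
Avoids021 xs = (i j k : Fin (length xs)) → toℕ i < toℕ j → toℕ j < toℕ k →
  ¬ (lookup xs i < lookup xs k × lookup xs k < lookup xs j)

-- restricted: x_i ≥ m_i - 1 with m_i = max(x_1,…,x_{i-1}), for 2 ≤ i ≤ n
-- (truncated subtraction is harmless: if m_i = 0 the condition x_i ≥ -1 is vacuous)
IsRestricted : List ℕ → Set
IsRestricted xs = IsAscentSeq xs ×
  ((i : Fin (length xs)) → 1 ≤ toℕ i → maxL (take (toℕ i) xs) ∸ 1 ≤ lookup xs i)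

R : ℕ → List ℕ → Set
R n xs = length xs ≡ n × IsRestricted xs

A : ℕ → List ℕ → Set
A n xs = length xs ≡ n × IsAscentSeq xs × Avoids021 xs

catalan : ℕ → ℕ
catalan n = ((2 * n) C n) / suc n

module Submission where

-- Both families are generated entry by entry, and whether an entry v may be appended
-- depends only on the state (a, M, l) = (ascents, maximum, last entry) of the prefix:
-- a restricted sequence allows M - 1 ≤ v ≤ a + 1, a 021-avoiding one allows v = 0 or
-- M ≤ v ≤ a + 1 (the 021 pattern is absent exactly when every entry is 0 or a weak
-- left-to-right maximum).  The bijection collapses each entry equal to M - 1 (M ≥ 2) to 0;
-- its inverse restores 0 to M - 1.  Tracking the relation between the last entries of a
-- sequence and of its image shows that ascents are created at the same steps.
--
-- For the count, the restricted sequences are listed by a finite generation tree whose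
-- subtree sizes depend only on the slack a + 1 - M and on whether l = M or l = M - 1.
-- These sizes are iterated backward differences of the ballot numbers of the Catalan
-- tree, so the number of sequences of length m + 1 is ballot m 2 = C(m+1).

open import Defs
open import Data.Nat using (ℕ; _≤_)
open import Data.List using (List; length)
open import Data.List.Membership.Propositional using (_∈_)
open import Data.List.Relation.Unary.Unique.Propositional using (Unique)
open import Data.Product using (Σ; ∃; _×_)
open import Function.Bundles using (_⇔_)
open import Relation.Binary.PropositionalEquality using (_≡_)

module Ballot where

  open import Data.Nat
  open import Data.Nat.Properties
  open import Data.Nat.Combinatorics using (_C_; nCk+nC[k+1]≡[n+1]C[k+1]; nC1≡n; nCk≡nC[n∸k])
  open import Data.Nat.DivMod using (m*n/n≡m)
  open import Data.Nat.Tactic.RingSolver using (solve-∀)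
  open import Relation.Binary.PropositionalEquality
  open ≡-Reasoning

  pascal : ∀ n k → n C k + n C suc k ≡ suc n C suc k
  pascal = nCk+nC[k+1]≡[n+1]C[k+1]

  C-absorption : ∀ m k → suc k * (suc m C suc k) ≡ suc m * (m C k)
  C-absorption zero    zero    = refl
  C-absorption zero    (suc k) = *-zeroʳ (suc (suc k))
  C-absorption (suc m) zero    = begin
    1 * (suc (suc m) C 1)  ≡⟨ *-identityˡ _ ⟩
    suc (suc m) C 1        ≡⟨ nC1≡n (suc (suc m)) ⟩
    suc (suc m)            ≡⟨ *-identityʳ (suc (suc m)) ⟨
    suc (suc m) * 1        ∎
  C-absorption (suc m) (suc k) = begin
    suc (suc k) * (suc (suc m) C suc (suc k))
      ≡⟨ cong (suc (suc k) *_) (pascal (suc m) (suc k)) ⟨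
    suc (suc k) * (X + Y)
      ≡⟨ *-distribˡ-+ (suc (suc k)) X Y ⟩
    (X + suc k * X) + suc (suc k) * Y
      ≡⟨ cong₂ (λ u w → (X + u) + w) (C-absorption m k) (C-absorption m (suc k)) ⟩
    (X + suc m * (m C k)) + suc m * (m C suc k)
      ≡⟨ +-assoc X _ _ ⟩
    X + (suc m * (m C k) + suc m * (m C suc k))
      ≡⟨ cong (X +_) (*-distribˡ-+ (suc m) (m C k) (m C suc k)) ⟨
    X + suc m * (m C k + m C suc k)
      ≡⟨ cong (λ u → X + suc m * u) (pascal m k) ⟩
    X + suc m * X ∎
    where
    X Y : ℕ
    X = suc m C suc k
    Y = suc m C suc (suc k)

  -- Ratio of neighbouring binomials, (k+1)·C(n,k+1) = (n-k)·C(n,k), in subtraction-free form.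
  C-ratio : ∀ n k → suc k * (n C suc k) + k * (n C k) ≡ n * (n C k)
  C-ratio zero    zero    = refl
  C-ratio zero    (suc k) = cong₂ _+_ (*-zeroʳ (suc (suc k))) (*-zeroʳ (suc k))
  C-ratio (suc m) zero    = begin
    1 * (suc m C 1) + 0  ≡⟨ +-identityʳ _ ⟩
    1 * (suc m C 1)      ≡⟨ C-absorption m 0 ⟩
    suc m * 1            ∎
  C-ratio (suc m) (suc k) = begin
    suc (suc k) * (suc m C suc (suc k)) + suc k * (suc m C suc k)
      ≡⟨ cong₂ _+_ (C-absorption m (suc k)) (C-absorption m k) ⟩
    suc m * (m C suc k) + suc m * (m C k)
      ≡⟨ *-distribˡ-+ (suc m) (m C suc k) (m C k) ⟨
    suc m * (m C suc k + m C k)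
      ≡⟨ cong (suc m *_) (+-comm (m C suc k) (m C k)) ⟩
    suc m * (m C k + m C suc k)
      ≡⟨ cong (suc m *_) (pascal m k) ⟩
    suc m * (suc m C suc k) ∎

  C-middle : ∀ m → suc (suc (suc (m + m))) C suc m ≡ suc (suc (suc (m + m))) C suc (suc m)
  C-middle m = begin
    n C suc m          ≡⟨ nCk≡nC[n∸k] (s≤s (≤-trans (m≤m+n m m) (≤-trans (n≤1+n _) (n≤1+n _)))) ⟩
    n C (n ∸ suc m)    ≡⟨ cong (n C_) complement ⟩
    n C suc (suc m)    ∎
    where
    n : ℕ
    n = suc (suc (suc (m + m)))
    complement : n ∸ suc m ≡ suc (suc m)
    complement = begin
      suc (suc (m + m)) ∸ m  ≡⟨ +-∸-assoc 2 (m≤m+n m m) ⟩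
      suc (suc (m + m ∸ m))  ≡⟨ cong (λ z → suc (suc z)) (m+n∸m≡n m m) ⟩
      suc (suc m)            ∎

  -- ballot r k counts the paths of length r from a node labelled k in the Catalan
  -- generating tree, in which a node labelled k has children labelled 2, 3, …, k+1.
  ballot : ℕ → ℕ → ℕ
  ballot zero    k       = 1
  ballot (suc r) zero    = 0
  ballot (suc r) (suc k) = ballot (suc r) k + ballot r (suc (suc k))

  ballot-one : ∀ k → ballot 1 k ≡ k
  ballot-one zero    = refl
  ballot-one (suc k) = trans (+-comm (ballot 1 k) 1) (cong suc (ballot-one k))

  row : ℕ → ℕ → ℕ
  row r k = suc (suc (k + (r + r)))

  row-suc : ∀ r k → row (suc r) k ≡ row r (suc (suc k))
  row-suc r k = cong (λ z → suc (suc z)) (begin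
    k + suc (r + suc r)    ≡⟨ +-suc k (r + suc r) ⟩
    suc (k + (r + suc r))  ≡⟨ cong (λ z → suc (k + z)) (+-suc r r) ⟩
    suc (k + suc (r + r))  ≡⟨ cong suc (+-suc k (r + r)) ⟩
    suc (suc (k + (r + r))) ∎)

  -- Closed form of the ballot numbers: ballot (r+1) (k+1) = C(2r+k+2, r+1) - C(2r+k+2, r).
  -- The induction follows the recursion of ballot, each step being Pascal's rule.
  ballot-closed : ∀ r k → ballot (suc r) (suc k) + row r k C r ≡ row r k C suc r
  ballot-closed zero    k       = begin
    ballot 1 (suc k) + 1  ≡⟨ cong (_+ 1) (ballot-one (suc k)) ⟩
    suc k + 1             ≡⟨ +-comm (suc k) 1 ⟩
    suc (suc k)           ≡⟨ cong (λ z → suc (suc z)) (+-identityʳ k) ⟨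
    row 0 k               ≡⟨ nC1≡n (row 0 k) ⟨
    row 0 k C 1           ∎
  ballot-closed (suc r) zero    =
    subst (λ m → g + m C suc r ≡ m C suc (suc r)) (sym (row-suc r 0)) (begin
    g + suc n C suc r                   ≡⟨ cong (g +_) (pascal n r) ⟨
    g + (n C r + n C suc r)             ≡⟨ +-assoc g (n C r) _ ⟨
    (g + n C r) + n C suc r             ≡⟨ cong (_+ n C suc r) (ballot-closed r 1) ⟩
    n C suc r + n C suc r               ≡⟨ cong (n C suc r +_) (C-middle r) ⟩
    n C suc r + n C suc (suc r)         ≡⟨ pascal n (suc r) ⟩
    suc n C suc (suc r)                 ∎)
    where
    g n : ℕ
    g = ballot (suc r) 2
    n = row r 1
  ballot-closed (suc r) (suc k) = begin
    (g₁ + g₂) + suc n C suc r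
      ≡⟨ cong ((g₁ + g₂) +_) (pascal n r) ⟨
    (g₁ + g₂) + (n C r + n C suc r)
      ≡⟨ interchange g₁ g₂ (n C r) (n C suc r) ⟩
    (g₁ + n C suc r) + (g₂ + n C r)
      ≡⟨ cong₂ _+_ (ballot-closed (suc r) k) shifted ⟩
    n C suc (suc r) + n C suc r
      ≡⟨ +-comm (n C suc (suc r)) (n C suc r) ⟩
    n C suc r + n C suc (suc r)
      ≡⟨ pascal n (suc r) ⟩
    suc n C suc (suc r) ∎
    where
    g₁ g₂ n : ℕ
    g₁ = ballot (suc (suc r)) (suc k)
    g₂ = ballot (suc r) (suc (suc (suc k)))
    n = row (suc r) k
    interchange : ∀ a b c d → (a + b) + (c + d) ≡ (a + d) + (b + c)
    interchange = solve-∀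
    shifted : g₂ + n C r ≡ n C suc r
    shifted = subst (λ m → g₂ + m C r ≡ m C suc r) (sym (row-suc r k)) (ballot-closed r (suc (suc k)))

  ballot-two-arith : ∀ r g X Y → g + Y ≡ X → suc r * X + r * Y ≡ suc (suc (suc (r + r))) * Y →
    g * suc (suc (suc r)) ≡ X + X
  ballot-two-arith r g X Y closed ratio = +-cancelʳ-≡ (suc r * X) _ _ (begin
      g * K + suc r * X   ≡⟨ cong (g * K +_) ratio′ ⟨
      g * K + K * Y       ≡⟨ distrib r g Y ⟩
      (g + Y) * K         ≡⟨ cong (_* K) closed ⟩
      X * K               ≡⟨ split r X ⟩
      (X + X) + suc r * X ∎)
    where
    K : ℕ
    K = suc (suc (suc r))
    regroup : ∀ r Y → r * Y + suc (suc (suc r)) * Y ≡ suc (suc (suc (r + r))) * Y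
    regroup = solve-∀
    distrib : ∀ r g Y → g * suc (suc (suc r)) + suc (suc (suc r)) * Y ≡ (g + Y) * suc (suc (suc r))
    distrib = solve-∀
    split : ∀ r X → X * suc (suc (suc r)) ≡ (X + X) + suc r * X
    split = solve-∀
    ratio′ : K * Y ≡ suc r * X
    ratio′ = +-cancelˡ-≡ (r * Y) _ _ (begin
      r * Y + K * Y                     ≡⟨ regroup r Y ⟩
      suc (suc (suc (r + r))) * Y       ≡⟨ ratio ⟨
      suc r * X + r * Y                 ≡⟨ +-comm (suc r * X) (r * Y) ⟩
      r * Y + suc r * X                 ∎)

  ballot-two : ∀ r → ballot r 2 * suc (suc r) ≡ (2 * suc r) C suc r
  ballot-two zero    = refl
  ballot-two (suc r) = begin
    ballot (suc r) 2 * suc (suc (suc r))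
      ≡⟨ ballot-two-arith r (ballot (suc r) 2) X Y (ballot-closed r 1) (C-ratio n r) ⟩
    X + X
      ≡⟨ cong (X +_) (C-middle r) ⟩
    X + n C suc (suc r)
      ≡⟨ pascal n (suc r) ⟩
    suc n C suc (suc r)
      ≡⟨ cong (_C suc (suc r)) (double r) ⟩
    (2 * suc (suc r)) C suc (suc r) ∎
    where
    n X Y : ℕ
    n = row r 1
    X = n C suc r
    Y = n C r
    double : ∀ r → suc (suc (suc (suc (r + r)))) ≡ 2 * suc (suc r)
    double = solve-∀

  ballot-catalan : ∀ r → ballot r 2 ≡ catalan (suc r)
  ballot-catalan r = begin
    ballot r 2                                          ≡⟨ m*n/n≡m (ballot r 2) (suc (suc r)) ⟨
    (ballot r 2 * suc (suc r)) / suc (suc r)            ≡⟨ cong (_/ suc (suc r)) (ballot-two r) ⟩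
    catalan (suc r)                                     ∎

module TreeCounts where

  open Ballot
  open import Data.Nat as ℕ using (ℕ; zero; suc)
  import Data.Nat.Properties as ℕₚ
  open import Data.Integer using (ℤ; +_; _+_; _-_)
  open import Data.Integer.Properties using (pos-+; +-injective)
  open import Data.Integer.Tactic.RingSolver using (solve-∀)
  open import Data.Product using (_×_; _,_; proj₁; proj₂)
  open import Relation.Binary.PropositionalEquality
  open ≡-Reasoning

  -- A state is summarised by
  -- its slack t = (number of ascents) + 1 - (maximum) and by whether the last entry is the
  -- maximum ("top") or one less ("below").  countTop r t and countBelow r t count the
  -- continuations of length r, and sumTop r t = countTop r 1 + … + countTop r t.
  mutual
    countTop : ℕ → ℕ → ℕ
    countTop zero    t = 1
    countTop (suc r) t = countBelow r t ℕ.+ countTop r t ℕ.+ sumTop r t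

    countBelow : ℕ → ℕ → ℕ
    countBelow zero    t = 1
    countBelow (suc r) t = countBelow r t ℕ.+ sumTop r (suc t)

    sumTop : ℕ → ℕ → ℕ
    sumTop r zero    = 0
    sumTop r (suc t) = sumTop r t ℕ.+ countTop r (suc t)

  -- The counts are iterated differences of ballot numbers; since differences need signs,
  -- this part of the computation takes place in ℤ.
  -- diff j k r: the j-th backward difference of r ↦ ballot r k (extended by 0 to r = -1).
  diff : ℕ → ℕ → ℕ → ℤ
  diff zero    k r       = + ballot r k
  diff (suc j) k zero    = diff j k zero
  diff (suc j) k (suc r) = diff j k (suc r) - diff j k r

  diff-zero : ∀ j k → diff j k 0 ≡ + 1
  diff-zero zero    k = refl
  diff-zero (suc j) k = diff-zero j k

  -- The ballot recurrence is linear, so it survives taking differences.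
  diff-recurrence : ∀ j k r → diff j (suc k) (suc r) ≡ diff j k (suc r) + diff j (suc (suc k)) r
  diff-recurrence zero    k r       = pos-+ (ballot (suc r) k) (ballot r (suc (suc k)))
  diff-recurrence (suc j) k zero    = begin
    diff j (suc k) 1 - diff j (suc k) 0
      ≡⟨ cong₂ _-_ (diff-recurrence j k 0) (diff-zero j (suc k)) ⟩
    (diff j k 1 + diff j (suc (suc k)) 0) - + 1
      ≡⟨ cong (λ z → (diff j k 1 + z) - + 1) (diff-zero j (suc (suc k))) ⟩
    (diff j k 1 + + 1) - + 1
      ≡⟨ move (diff j k 1) ⟩
    (diff j k 1 - + 1) + + 1
      ≡⟨ cong₂ (λ a b → (diff j k 1 - a) + b) (diff-zero j k) (diff-zero j (suc (suc k))) ⟨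
    (diff j k 1 - diff j k 0) + diff j (suc (suc k)) 0 ∎
    where
    move : ∀ a → (a + + 1) - + 1 ≡ (a - + 1) + + 1
    move = solve-∀
  diff-recurrence (suc j) k (suc r) = begin
    diff j (suc k) (suc (suc r)) - diff j (suc k) (suc r)
      ≡⟨ cong₂ _-_ (diff-recurrence j k (suc r)) (diff-recurrence j k r) ⟩
    (diff j k (suc (suc r)) + diff j (suc (suc k)) (suc r)) - (diff j k (suc r) + diff j (suc (suc k)) r)
      ≡⟨ regroup (diff j k (suc (suc r))) (diff j (suc (suc k)) (suc r)) (diff j k (suc r)) (diff j (suc (suc k)) r) ⟩
    (diff j k (suc (suc r)) - diff j k (suc r)) + (diff j (suc (suc k)) (suc r) - diff j (suc (suc k)) r) ∎
    where
    regroup : ∀ a b c d → (a + b) - (c + d) ≡ (a - c) + (b - d)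
    regroup = solve-∀

  -- Applying the recurrence twice: one more difference trades the label k+2 for k and k+3.
  diff-telescope : ∀ j k r → diff (suc j) (suc (suc k)) (suc r) ≡ diff j k (suc r) + diff j (suc (suc (suc k))) r
  diff-telescope j k r = begin
    diff j (suc (suc k)) (suc r) - diff j (suc (suc k)) r
      ≡⟨ cong (_- diff j (suc (suc k)) r) (diff-recurrence j (suc k) r) ⟩
    (diff j (suc k) (suc r) + diff j (suc (suc (suc k))) r) - diff j (suc (suc k)) r
      ≡⟨ cong (λ z → (z + diff j (suc (suc (suc k))) r) - diff j (suc (suc k)) r) (diff-recurrence j k r) ⟩
    ((diff j k (suc r) + diff j (suc (suc k)) r) + diff j (suc (suc (suc k))) r) - diff j (suc (suc k)) r
      ≡⟨ cancel (diff j k (suc r)) (diff j (suc (suc k)) r) (diff j (suc (suc (suc k))) r) ⟩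
    diff j k (suc r) + diff j (suc (suc (suc k))) r ∎
    where
    cancel : ∀ a b c → ((a + b) + c) - b ≡ a + c
    cancel = solve-∀

  pos-+₃ : ∀ a b c → + (a ℕ.+ b ℕ.+ c) ≡ (+ a + + b) + + c
  pos-+₃ a b c = trans (pos-+ (a ℕ.+ b) c) (cong (_+ + c) (pos-+ a b))

  double : ℕ → ℕ
  double s = s ℕ.+ s

  double-suc : ∀ s → double (suc s) ≡ suc (suc (double s))
  double-suc s = cong suc (ℕₚ.+-suc s s)

  TopForm BelowForm SumForm : ℕ → Set
  TopForm r   = ∀ s → + countTop r (suc s) ≡ diff s (suc (suc (suc (double s)))) r
  BelowForm r = ∀ s → + countBelow r s ≡ diff s (suc (suc (double s))) r
  SumForm r   = ∀ s → + sumTop r s ≡ diff s (double s) (suc r)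

  -- Summing the closed forms of countTop telescopes to the closed form of sumTop.
  sum-form : ∀ r → TopForm r → SumForm r
  sum-form r top zero    = refl
  sum-form r top (suc s) = begin
    + (sumTop r s ℕ.+ countTop r (suc s))
      ≡⟨ pos-+ (sumTop r s) (countTop r (suc s)) ⟩
    + sumTop r s + + countTop r (suc s)
      ≡⟨ cong₂ _+_ (sum-form r top s) (top s) ⟩
    diff s (double s) (suc r) + diff s (suc (suc (suc (double s)))) r
      ≡⟨ diff-telescope s (double s) r ⟨
    diff (suc s) (suc (suc (double s))) (suc r)
      ≡⟨ cong (λ k → diff (suc s) k (suc r)) (double-suc s) ⟨
    diff (suc s) (double (suc s)) (suc r) ∎

  sum-form-suc : ∀ r → TopForm r → ∀ s → + sumTop r (suc s) ≡ diff (suc s) (suc (suc (double s))) (suc r)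
  sum-form-suc r top s = trans (sum-form r top (suc s)) (cong (λ k → diff (suc s) k (suc r)) (double-suc s))

  top-form-step : ∀ r → TopForm r → BelowForm r → TopForm (suc r)
  top-form-step r top below s = begin
    + (countBelow r (suc s) ℕ.+ countTop r (suc s) ℕ.+ sumTop r (suc s))
      ≡⟨ pos-+₃ (countBelow r (suc s)) (countTop r (suc s)) (sumTop r (suc s)) ⟩
    (+ countBelow r (suc s) + + countTop r (suc s)) + + sumTop r (suc s)
      ≡⟨ cong₂ _+_ (cong₂ _+_ below-s (top s)) (sum-form-suc r top s) ⟩
    (diff (suc s) (suc (suc K)) r + diff s (suc K) r) + diff (suc s) K (suc r)
      ≡⟨ rotate (diff (suc s) (suc (suc K)) r) (diff s (suc K) r) (diff (suc s) K (suc r)) ⟩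
    (diff (suc s) K (suc r) + diff (suc s) (suc (suc K)) r) + diff s (suc K) r
      ≡⟨ cong (_+ diff s (suc K) r) (diff-recurrence (suc s) K r) ⟨
    diff (suc s) (suc K) (suc r) + diff s (suc K) r
      ≡⟨ undo (diff s (suc K) (suc r)) (diff s (suc K) r) ⟩
    diff s (suc K) (suc r) ∎
    where
    K : ℕ
    K = suc (suc (double s))
    below-s : + countBelow r (suc s) ≡ diff (suc s) (suc (suc K)) r
    below-s = trans (below (suc s)) (cong (λ k → diff (suc s) (suc (suc k)) r) (double-suc s))
    rotate : ∀ a b c → (a + b) + c ≡ (c + a) + b
    rotate = solve-∀
    undo : ∀ a b → (a - b) + b ≡ a
    undo = solve-∀

  below-form-step : ∀ r → TopForm r → BelowForm r → BelowForm (suc r)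
  below-form-step r top below s = begin
    + (countBelow r s ℕ.+ sumTop r (suc s))       ≡⟨ pos-+ (countBelow r s) (sumTop r (suc s)) ⟩
    + countBelow r s + + sumTop r (suc s)         ≡⟨ cong₂ _+_ (below s) (sum-form-suc r top s) ⟩
    diff s K r + (diff s K (suc r) - diff s K r)  ≡⟨ undo (diff s K (suc r)) (diff s K r) ⟩
    diff s K (suc r)                              ∎
    where
    K : ℕ
    K = suc (suc (double s))
    undo : ∀ a b → b + (a - b) ≡ a
    undo = solve-∀

  top-below-forms : ∀ r → TopForm r × BelowForm r
  top-below-forms zero    = (λ s → sym (diff-zero s _)) , (λ s → sym (diff-zero s _))
  top-below-forms (suc r) with top-below-forms r
  ... | top , below = top-form-step r top below , below-form-step r top below

  countBelow-ballot : ∀ r → countBelow r 0 ≡ ballot r 2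
  countBelow-ballot r = +-injective (proj₂ (top-below-forms r) 0)

module Tails where

  open import Data.Nat
  open import Data.Nat.Properties
  open import Data.Bool using (true; false; if_then_else_)
  open import Data.Unit using (⊤; tt)
  open import Data.Empty using (⊥-elim)
  open import Data.Sum using (_⊎_)
  open import Data.Product using (_×_)
  open import Data.List using (List; []; _∷_)
  open import Relation.Binary.PropositionalEquality

  ascBit : ℕ → ℕ → ℕ
  ascBit l v = if l <ᵇ v then 1 else 0

  ascBit-< : ∀ {l v} → l < v → ascBit l v ≡ 1
  ascBit-< {l} {v} l<v with l <ᵇ v | <⇒<ᵇ l<v
  ... | true | _ = refl

  ascBit-≥ : ∀ {l v} → v ≤ l → ascBit l v ≡ 0
  ascBit-≥ {l} {v} v≤l with l <ᵇ v | <ᵇ⇒< l v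
  ... | false | _      = refl
  ... | true  | l<v = ⊥-elim (<⇒≱ (l<v tt) v≤l)

  -- Tail P a M l xs: xs is a possible continuation of an ascent sequence whose prefix has
  -- a ascents, maximum M and last entry l, when each new entry v must also satisfy P M v.
  -- Only (a, M, l) matters, so both families are generated by local rules.
  Tail : (ℕ → ℕ → Set) → ℕ → ℕ → ℕ → List ℕ → Set
  Tail P a M l []       = ⊤
  Tail P a M l (v ∷ vs) = P M v × v ≤ suc a × Tail P (a + ascBit l v) (M ⊔ v) v vs

  RStep : ℕ → ℕ → Set
  RStep M v = M ∸ 1 ≤ v

  AStep : ℕ → ℕ → Set
  AStep M v = v ≡ 0 ⊎ M ≤ v

module Bijection where

  open Tails
  open import Data.Nat
  open import Data.Nat.Properties
  open import Data.Unit using (tt)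
  open import Data.Empty using (⊥-elim)
  open import Data.Sum using (inj₁; inj₂)
  open import Data.Product using (_,_)
  open import Data.List using (List; []; _∷_; length)
  open import Relation.Nullary using (yes; no)
  open import Relation.Binary.PropositionalEquality

  collapse : ℕ → ℕ → ℕ
  collapse zero          v = v
  collapse (suc zero)    v = v
  collapse (suc (suc m)) v with v ≟ suc m
  ... | yes _ = 0
  ... | no  _ = v

  restore : ℕ → ℕ → ℕ
  restore zero          w       = w
  restore (suc zero)    w       = w
  restore (suc (suc m)) zero    = suc m
  restore (suc (suc m)) (suc w) = suc w

  data CollapseView (M v : ℕ) : ℕ → Set where
    collapsed     : 2 ≤ M → v ≡ M ∸ 1 → CollapseView M v 0
    not-collapsed : (2 ≤ M → v ≢ M ∸ 1) → CollapseView M v v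

  collapse-view : ∀ M v → CollapseView M v (collapse M v)
  collapse-view zero          v = not-collapsed (λ ())
  collapse-view (suc zero)    v = not-collapsed (λ { (s≤s ()) })
  collapse-view (suc (suc m)) v with v ≟ suc m
  ... | yes v≡ = collapsed (s≤s (s≤s z≤n)) v≡
  ... | no  v≢ = not-collapsed (λ _ → v≢)

  data RestoreView (M w : ℕ) : ℕ → Set where
    restored     : 2 ≤ M → w ≡ 0 → RestoreView M w (M ∸ 1)
    not-restored : (2 ≤ M → w ≢ 0) → RestoreView M w w

  restore-view : ∀ M w → RestoreView M w (restore M w)
  restore-view zero          w       = not-restored (λ ())
  restore-view (suc zero)    w       = not-restored (λ { (s≤s ()) })
  restore-view (suc (suc m)) zero    = restored (s≤s (s≤s z≤n)) refl
  restore-view (suc (suc m)) (suc w) = not-restored (λ _ ())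

  forward : ℕ → List ℕ → List ℕ
  forward M []       = []
  forward M (v ∷ vs) = collapse M v ∷ forward (M ⊔ v) vs

  backward : ℕ → List ℕ → List ℕ
  backward M []       = []
  backward M (w ∷ ws) = restore M w ∷ backward (M ⊔ restore M w) ws

  forward-length : ∀ M xs → length (forward M xs) ≡ length xs
  forward-length M []       = refl
  forward-length M (v ∷ vs) = cong suc (forward-length (M ⊔ v) vs)

  backward-length : ∀ M ys → length (backward M ys) ≡ length ys
  backward-length M []       = refl
  backward-length M (w ∷ ws) = cong suc (backward-length (M ⊔ restore M w) ws)

  M∸1≤M : ∀ M → M ∸ 1 ≤ M
  M∸1≤M M = m∸n≤m M 1

  M∸1<M : ∀ {M} → 2 ≤ M → M ∸ 1 < M
  M∸1<M {suc zero}    (s≤s ())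
  M∸1<M {suc (suc m)} _ = ≤-refl

  M⊔M∸1 : ∀ M → M ⊔ (M ∸ 1) ≡ M
  M⊔M∸1 M = m≥n⇒m⊔n≡m (M∸1≤M M)

  RStep⇒AStep : ∀ M v → RStep M v → (2 ≤ M → v ≢ M ∸ 1) → AStep M v
  RStep⇒AStep zero          v       _   _  = inj₂ z≤n
  RStep⇒AStep (suc zero)    zero    _   _  = inj₁ refl
  RStep⇒AStep (suc zero)    (suc v) _   _  = inj₂ (s≤s z≤n)
  RStep⇒AStep (suc (suc m)) v       m≤v v≢ = inj₂ (≤∧≢⇒< m≤v (λ m≡v → v≢ (s≤s (s≤s z≤n)) (sym m≡v)))

  RStep-⊔ : ∀ M v → RStep M v → RStep (M ⊔ v) v
  RStep-⊔ M v M∸1≤v with ≤-total M v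
  ... | inj₁ M≤v = subst (λ z → z ∸ 1 ≤ v) (sym (m≤n⇒m⊔n≡n M≤v)) (m∸n≤m v 1)
  ... | inj₂ v≤M = subst (λ z → z ∸ 1 ≤ v) (sym (m≥n⇒m⊔n≡m v≤M)) M∸1≤v

  AStep⇒RStep : ∀ M w → AStep M w → (2 ≤ M → w ≢ 0) → RStep M w
  AStep⇒RStep M w (inj₂ M≤w) _ = ≤-trans (M∸1≤M M) M≤w
  AStep⇒RStep zero          .0 (inj₁ refl) _  = z≤n
  AStep⇒RStep (suc zero)    .0 (inj₁ refl) _  = z≤n
  AStep⇒RStep (suc (suc m)) .0 (inj₁ refl) w≢ = ⊥-elim (w≢ (s≤s (s≤s z≤n)) refl)

  collapse-AStep : ∀ M v → RStep M v → AStep M (collapse M v)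
  collapse-AStep M v M∸1≤v with collapse M v | collapse-view M v
  ... | _ | collapsed _ _  = inj₁ refl
  ... | _ | not-collapsed v≢ = RStep⇒AStep M v M∸1≤v v≢

  collapse-≤ : ∀ M v → collapse M v ≤ v
  collapse-≤ M v with collapse M v | collapse-view M v
  ... | _ | collapsed _ _   = z≤n
  ... | _ | not-collapsed _ = ≤-refl

  ⊔-collapse : ∀ M v → M ⊔ collapse M v ≡ M ⊔ v
  ⊔-collapse M v with collapse M v | collapse-view M v
  ... | _ | collapsed _ refl = trans (⊔-identityʳ M) (sym (M⊔M∸1 M))
  ... | _ | not-collapsed _  = refl

  restore-collapse : ∀ M v → RStep M v → restore M (collapse M v) ≡ v
  restore-collapse M v M∸1≤v with collapse M v | collapse-view M v
  ... | _ | collapsed 2≤M refl with restore M 0 | restore-view M 0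
  ...   | _ | restored _ _        = refl
  ...   | _ | not-restored 0≢     = ⊥-elim (0≢ 2≤M refl)
  restore-collapse M v M∸1≤v | _ | not-collapsed v≢ with restore M v | restore-view M v
  ...   | _ | not-restored _      = refl
  ...   | _ | restored 2≤M refl   = ⊥-elim (v≢ 2≤M (sym (n≤0⇒n≡0 M∸1≤v)))

  restore-RStep : ∀ M w → AStep M w → RStep M (restore M w)
  restore-RStep M w w-ok with restore M w | restore-view M w
  ... | _ | restored _ _     = ≤-refl
  ... | _ | not-restored w≢ = AStep⇒RStep M w w-ok w≢

  restore-≤ : ∀ M w a → w ≤ suc a → M ≤ suc a → restore M w ≤ suc a
  restore-≤ M w a w≤ M≤ with restore M w | restore-view M w
  ... | _ | restored _ _     = ≤-trans (M∸1≤M M) M≤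
  ... | _ | not-restored _   = w≤

  ⊔-restore : ∀ M w → M ⊔ restore M w ≡ M ⊔ w
  ⊔-restore M w with restore M w | restore-view M w
  ... | _ | restored _ refl  = trans (M⊔M∸1 M) (sym (⊔-identityʳ M))
  ... | _ | not-restored _   = refl

  collapse-restore : ∀ M w → AStep M w → collapse M (restore M w) ≡ w
  collapse-restore M w w-ok with restore M w | restore-view M w
  ... | _ | restored 2≤M refl with collapse M (M ∸ 1) | collapse-view M (M ∸ 1)
  ...   | _ | collapsed _ _       = refl
  ...   | _ | not-collapsed v≢    = ⊥-elim (v≢ 2≤M refl)
  collapse-restore M w w-ok | _ | not-restored w≢ with collapse M w | collapse-view M w
  ...   | _ | not-collapsed _     = refl
  ...   | _ | collapsed 2≤M refl with w-ok
  ...     | inj₁ w≡0 = ⊥-elim (w≢ 2≤M w≡0)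
  ...     | inj₂ M≤w = ⊥-elim (<⇒≱ (M∸1<M 2≤M) M≤w)

  -- How the last entries l of a restricted prefix and l' of its image are related.
  data LastRel (M : ℕ) : ℕ → ℕ → Set where
    last-same      : ∀ {l} → RStep M l → LastRel M l l
    last-collapsed : 2 ≤ M → LastRel M (M ∸ 1) 0

  lastRel-collapse : ∀ M v → RStep M v → LastRel (M ⊔ v) v (collapse M v)
  lastRel-collapse M v M∸1≤v with collapse M v | collapse-view M v
  ... | _ | collapsed 2≤M refl =
    subst (λ M′ → LastRel M′ (M ∸ 1) 0) (sym (M⊔M∸1 M)) (last-collapsed 2≤M)
  ... | _ | not-collapsed _    = last-same (RStep-⊔ M v M∸1≤v)

  lastRel-restore : ∀ M w → AStep M w → LastRel (M ⊔ restore M w) (restore M w) w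
  lastRel-restore M w w-ok with restore M w | restore-view M w
  ... | _ | restored 2≤M refl =
    subst (λ M′ → LastRel M′ (M ∸ 1) 0) (sym (M⊔M∸1 M)) (last-collapsed 2≤M)
  ... | _ | not-restored w≢   = last-same (RStep-⊔ M w (AStep⇒RStep M w w-ok w≢))

  ascBit-collapse : ∀ {M l l′} v → LastRel M l l′ → RStep M v → ascBit l v ≡ ascBit l′ (collapse M v)
  ascBit-collapse {M} v rel M∸1≤v with collapse M v | collapse-view M v
  ascBit-collapse v (last-same M∸1≤l)    _ | _ | collapsed _ refl = ascBit-≥ M∸1≤l
  ascBit-collapse v (last-same _)        _ | _ | not-collapsed _  = refl
  ascBit-collapse {M} v (last-collapsed _) _ | _ | collapsed _ refl = ascBit-≥ (≤-refl {M ∸ 1})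
  ascBit-collapse {M} v (last-collapsed 2≤M) M∸1≤v | _ | not-collapsed v≢ =
    trans (ascBit-< M∸1<v) (sym (ascBit-< (≤-trans (s≤s z≤n) M∸1<v)))
    where
    M∸1<v : M ∸ 1 < v
    M∸1<v = ≤∧≢⇒< M∸1≤v (λ e → v≢ 2≤M (sym e))

  ascBit-restore : ∀ {M l l′} w → LastRel M l l′ → AStep M w → ascBit l (restore M w) ≡ ascBit l′ w
  ascBit-restore {M} w rel w-ok with restore M w | restore-view M w
  ascBit-restore w (last-same M∸1≤l)  _ | _ | restored _ refl = ascBit-≥ M∸1≤l
  ascBit-restore w (last-same _)      _ | _ | not-restored _  = refl
  ascBit-restore {M} w (last-collapsed _) _ | _ | restored _ refl = ascBit-≥ (≤-refl {M ∸ 1})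
  ascBit-restore w (last-collapsed 2≤M) (inj₁ refl) | _ | not-restored w≢ = ⊥-elim (w≢ 2≤M refl)
  ascBit-restore {M} w (last-collapsed 2≤M) (inj₂ M≤w) | _ | not-restored _ =
    trans (ascBit-< M∸1<w) (sym (ascBit-< (≤-trans (s≤s z≤n) M∸1<w)))
    where
    M∸1<w : M ∸ 1 < w
    M∸1<w = <-≤-trans (M∸1<M 2≤M) M≤w

  forward-tail : ∀ {a M l l′} xs → LastRel M l l′ → Tail RStep a M l xs → Tail AStep a M l′ (forward M xs)
  forward-tail                []       _   _                     = tt
  forward-tail {a} {M} {l} {l′} (v ∷ vs) rel (v-ok , v≤ , vs-ok) =
    collapse-AStep M v v-ok , ≤-trans (collapse-≤ M v) v≤ ,
    subst₂ (λ a′ M′ → Tail AStep a′ M′ (collapse M v) (forward (M ⊔ v) vs))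
      (cong (a +_) (ascBit-collapse v rel v-ok)) (sym (⊔-collapse M v))
      (forward-tail vs (lastRel-collapse M v v-ok) vs-ok)

  forward-asc : ∀ {a M l l′} xs → LastRel M l l′ → Tail RStep a M l xs →
    asc (l′ ∷ forward M xs) ≡ asc (l ∷ xs)
  forward-asc         []       _   _                   = refl
  forward-asc {M = M} (v ∷ vs) rel (v-ok , _ , vs-ok) =
    cong₂ _+_ (sym (ascBit-collapse v rel v-ok)) (forward-asc vs (lastRel-collapse M v v-ok) vs-ok)

  -- backward maps 021-avoiding continuations to restricted ones; the invariant M ≤ a + 1
  -- (the maximum never exceeds the number of ascents plus one) bounds the restored entries.
  backward-tail : ∀ {a M l l′} ys → LastRel M l l′ → M ≤ suc a →
    Tail AStep a M l′ ys → Tail RStep a M l (backward M ys)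
  backward-tail                []       _   _   _                    = tt
  backward-tail {a} {M} {l} {l′} (w ∷ ws) rel M≤ (w-ok , w≤ , ws-ok) =
    restore-RStep M w w-ok , restore-≤ M w a w≤ M≤ ,
    backward-tail ws (lastRel-restore M w w-ok) M′≤ ws-ok′
    where
    a′ : ℕ
    a′ = a + ascBit l (restore M w)
    ws-ok′ : Tail AStep a′ (M ⊔ restore M w) w ws
    ws-ok′ = subst₂ (λ a″ M″ → Tail AStep a″ M″ w ws)
      (cong (a +_) (sym (ascBit-restore w rel w-ok))) (sym (⊔-restore M w)) ws-ok
    M′≤ : M ⊔ restore M w ≤ suc a′
    M′≤ = ⊔-lub (≤-trans M≤ (s≤s (m≤m+n a _))) (≤-trans (restore-≤ M w a w≤ M≤) (s≤s (m≤m+n a _)))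

  backward-forward : ∀ {a M l} xs → Tail RStep a M l xs → backward M (forward M xs) ≡ xs
  backward-forward         []       _                  = refl
  backward-forward {M = M} (v ∷ vs) (v-ok , _ , vs-ok) = cong₂ _∷_ (restore-collapse M v v-ok) (begin
    backward (M ⊔ restore M (collapse M v)) (forward (M ⊔ v) vs)
      ≡⟨ cong (λ u → backward (M ⊔ u) (forward (M ⊔ v) vs)) (restore-collapse M v v-ok) ⟩
    backward (M ⊔ v) (forward (M ⊔ v) vs)
      ≡⟨ backward-forward vs vs-ok ⟩
    vs ∎)
    where open ≡-Reasoning

  forward-backward : ∀ {a M l} ys → Tail AStep a M l ys → forward M (backward M ys) ≡ ys
  forward-backward         []       _                  = refl
  forward-backward {M = M} (w ∷ ws) (w-ok , _ , ws-ok) = cong₂ _∷_ (collapse-restore M w w-ok)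
    (forward-backward ws (subst (λ M′ → Tail AStep _ M′ w ws) (sym (⊔-restore M w)) ws-ok))

module Enumeration where

  open Tails
  open TreeCounts
  open import Data.Nat
  open import Data.Nat.Properties
  open import Data.Unit using (tt)
  open import Data.Empty using (⊥-elim)
  open import Relation.Nullary using (¬_)
  open import Data.Sum using (inj₁; inj₂)
  open import Data.Product using (_×_; _,_; Σ)
  open import Data.List using (List; []; _∷_; _++_; map; length)
  open import Data.Nat.ListAction using (sum)
  open import Data.List.Properties using (length-++; length-map)
  open import Data.List.Membership.Propositional using (_∈_)
  open import Data.List.Membership.Propositional.Properties using (∈-map⁺; ∈-map⁻; ∈-++⁺ˡ; ∈-++⁺ʳ; ∈-++⁻)
  open import Data.List.Relation.Unary.Any using (here; there)
  open import Data.List.Relation.Unary.All using (All; []; _∷_)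
  open import Data.List.Relation.Unary.All.Properties using (All¬⇒¬Any)
  open import Data.List.Relation.Unary.AllPairs using ([]; _∷_)
  open import Data.List.Relation.Unary.Unique.Propositional using (Unique)
  import Data.List.Relation.Unary.Unique.Propositional.Properties as Unique
  open import Relation.Binary.PropositionalEquality
  open ≡-Reasoning

  interval : ℕ → ℕ → List ℕ
  interval lo zero    = []
  interval lo (suc k) = lo ∷ interval (suc lo) k

  ∈-interval⁻ : ∀ {v} lo k → v ∈ interval lo k → lo ≤ v × v < lo + k
  ∈-interval⁻     lo (suc k) (here refl) = ≤-refl , m<m+n lo (s≤s z≤n)
  ∈-interval⁻ {v} lo (suc k) (there v∈) with ∈-interval⁻ (suc lo) k v∈
  ... | lo<v , v< = <⇒≤ lo<v , subst (v <_) (sym (+-suc lo k)) v<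

  ∈-interval⁺ : ∀ {v} lo k → lo ≤ v → v < lo + k → v ∈ interval lo k
  ∈-interval⁺ {v} lo zero    lo≤v v< = ⊥-elim (<⇒≱ v< (subst (_≤ v) (sym (+-identityʳ lo)) lo≤v))
  ∈-interval⁺ {v} lo (suc k) lo≤v v< with m≤n⇒m<n∨m≡n lo≤v
  ... | inj₂ refl = here refl
  ... | inj₁ lo<v = there (∈-interval⁺ (suc lo) k lo<v (subst (v <_) (+-suc lo k) v<))

  interval-unique : ∀ lo k → Unique (interval lo k)
  interval-unique lo zero    = []
  interval-unique lo (suc k) = all-above (suc lo) k ≤-refl ∷ interval-unique (suc lo) k
    where
    all-above : ∀ lo′ k′ → lo < lo′ → All (lo ≢_) (interval lo′ k′)
    all-above lo′ zero     _    = []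
    all-above lo′ (suc k′) lo<  = (λ e → <-irrefl e lo<) ∷ all-above (suc lo′) k′ (m<n⇒m<1+n lo<)

  candidates : ℕ → ℕ → List ℕ
  candidates a M = interval (M ∸ 1) (suc (suc a) ∸ (M ∸ 1))

  ∈-candidates⁺ : ∀ {v} a M → RStep M v → v ≤ suc a → v ∈ candidates a M
  ∈-candidates⁺ {v} a M M∸1≤v v≤ =
    ∈-interval⁺ (M ∸ 1) _ M∸1≤v (subst (v <_) (sym (m+[n∸m]≡n (≤-trans M∸1≤v (m≤n⇒m≤1+n v≤)))) (s≤s v≤))

  ∈-candidates⁻ : ∀ {v} a M → v ∈ candidates a M → RStep M v × v ≤ suc a
  ∈-candidates⁻ {v} a M v∈ with ∈-interval⁻ (M ∸ 1) _ v∈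
  ... | M∸1≤v , v< with ≤-total (M ∸ 1) (suc (suc a))
  ...   | inj₁ lo≤ = M∸1≤v , ≤-pred (subst (v <_) (m+[n∸m]≡n lo≤) v<)
  ...   | inj₂ hi≤ = ⊥-elim (<⇒≱ v<′ M∸1≤v)
    where
    v<′ : v < M ∸ 1
    v<′ = subst (v <_) (trans (cong (M ∸ 1 +_) (m≤n⇒m∸n≡0 hi≤)) (+-identityʳ (M ∸ 1))) v<

  prefixEach : List ℕ → (ℕ → List (List ℕ)) → List (List ℕ)
  prefixEach []       f = []
  prefixEach (v ∷ vs) f = map (v ∷_) (f v) ++ prefixEach vs f

  ∈-prefixEach⁺ : ∀ {v t} vs f → v ∈ vs → t ∈ f v → (v ∷ t) ∈ prefixEach vs f
  ∈-prefixEach⁺ (w ∷ vs) f (here refl) t∈ = ∈-++⁺ˡ (∈-map⁺ (w ∷_) t∈)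
  ∈-prefixEach⁺ (w ∷ vs) f (there v∈)  t∈ = ∈-++⁺ʳ (map (w ∷_) (f w)) (∈-prefixEach⁺ vs f v∈ t∈)

  ∈-prefixEach⁻ : ∀ {xs} vs f → xs ∈ prefixEach vs f →
    Σ ℕ λ v → Σ (List ℕ) λ t → xs ≡ v ∷ t × v ∈ vs × t ∈ f v
  ∈-prefixEach⁻ (w ∷ vs) f xs∈ with ∈-++⁻ (map (w ∷_) (f w)) xs∈
  ... | inj₁ xs∈ₗ with ∈-map⁻ (w ∷_) xs∈ₗ
  ...   | t , t∈ , refl = w , t , refl , here refl , t∈
  ∈-prefixEach⁻ (w ∷ vs) f xs∈ | inj₂ xs∈ᵣ with ∈-prefixEach⁻ vs f xs∈ᵣ
  ...   | v , t , refl , v∈ , t∈ = v , t , refl , there v∈ , t∈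

  prefixEach-unique : ∀ vs f → Unique vs → (∀ v → Unique (f v)) → Unique (prefixEach vs f)
  prefixEach-unique []       f _          _        = []
  prefixEach-unique (w ∷ vs) f (w∉ ∷ vs!) f-unique =
    Unique.++⁺ (Unique.map⁺ ∷-injectiveʳ (f-unique w)) (prefixEach-unique vs f vs! f-unique) disjoint
    where
    ∷-injectiveʳ : ∀ {x y : List ℕ} → w ∷ x ≡ w ∷ y → x ≡ y
    ∷-injectiveʳ refl = refl
    disjoint : ∀ {xs} → ¬ (xs ∈ map (w ∷_) (f w) × xs ∈ prefixEach vs f)
    disjoint (xs∈ₗ , xs∈ᵣ) with ∈-map⁻ (w ∷_) xs∈ₗ | ∈-prefixEach⁻ vs f xs∈ᵣ
    ... | _ , _ , refl | _ , _ , refl , w∈ , _ = All¬⇒¬Any w∉ w∈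

  prefixEach-length : ∀ vs f → length (prefixEach vs f) ≡ sum (map (λ v → length (f v)) vs)
  prefixEach-length []       f = refl
  prefixEach-length (v ∷ vs) f = begin
    length (map (v ∷_) (f v) ++ prefixEach vs f)
      ≡⟨ length-++ (map (v ∷_) (f v)) ⟩
    length (map (v ∷_) (f v)) + length (prefixEach vs f)
      ≡⟨ cong₂ _+_ (length-map (v ∷_) (f v)) (prefixEach-length vs f) ⟩
    length (f v) + sum (map (λ v → length (f v)) vs) ∎

  restrictedTails : ℕ → ℕ → ℕ → ℕ → List (List ℕ)
  restrictedTails a M l zero    = [] ∷ []
  restrictedTails a M l (suc r) =
    prefixEach (candidates a M) (λ v → restrictedTails (a + ascBit l v) (M ⊔ v) v r)

  ∈-restrictedTails⁺ : ∀ a M l r xs → length xs ≡ r → Tail RStep a M l xs → xs ∈ restrictedTails a M l r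
  ∈-restrictedTails⁺ a M l zero    []       _   _                    = here refl
  ∈-restrictedTails⁺ a M l (suc r) (v ∷ vs) len (v-ok , v≤ , vs-ok) =
    ∈-prefixEach⁺ (candidates a M) _ (∈-candidates⁺ a M v-ok v≤)
      (∈-restrictedTails⁺ _ _ _ r vs (suc-injective len) vs-ok)

  ∈-restrictedTails⁻ : ∀ a M l r xs → xs ∈ restrictedTails a M l r → length xs ≡ r × Tail RStep a M l xs
  ∈-restrictedTails⁻ a M l zero    .[] (here refl) = refl , tt
  ∈-restrictedTails⁻ a M l (suc r) xs  xs∈ with ∈-prefixEach⁻ (candidates a M) _ xs∈
  ... | v , t , refl , v∈ , t∈ with ∈-candidates⁻ a M v∈ | ∈-restrictedTails⁻ _ _ _ r t t∈
  ...   | v-ok , v≤ | len , t-ok = cong suc len , v-ok , v≤ , t-ok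

  restrictedTails-unique : ∀ a M l r → Unique (restrictedTails a M l r)
  restrictedTails-unique a M l zero    = [] ∷ []
  restrictedTails-unique a M l (suc r) =
    prefixEach-unique (candidates a M) _ (interval-unique _ _) (λ v → restrictedTails-unique _ _ _ r)

  -- Counting.  A state with slack t = a + 1 - M ≥ 1 has candidates M - 1, M, M + 1, …, M + t;
  -- the jumps M + 1, …, M + t all create an ascent and lead to top states of slack t, …, 1.
  #tails : ℕ → ℕ → ℕ → ℕ → ℕ
  #tails a M l r = length (restrictedTails a M l r)

  no-ascent : ∀ a {l v} → v ≤ l → a + ascBit l v ≡ a
  no-ascent a v≤l = trans (cong (a +_) (ascBit-≥ v≤l)) (+-identityʳ a)

  candidates-count : ∀ m s → suc (suc (m + suc s)) ∸ m ≡ suc (suc (suc s))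
  candidates-count m s = begin
    suc (suc (m + suc s)) ∸ m   ≡⟨ cong (λ z → suc z ∸ m) (+-suc m (suc s)) ⟨
    suc (m + suc (suc s)) ∸ m   ≡⟨ cong (_∸ m) (+-suc m (suc (suc s))) ⟨
    m + suc (suc (suc s)) ∸ m   ≡⟨ m+n∸m≡n m _ ⟩
    suc (suc (suc s))           ∎

  #tails-step : ∀ m s l r → #tails (m + suc s) (suc m) l (suc r) ≡
    sum (map (λ v → #tails (m + suc s + ascBit l v) (suc m ⊔ v) v r) (interval m (suc (suc (suc s)))))
  #tails-step m s l r = trans (prefixEach-length (candidates (m + suc s) (suc m)) _)
    (cong (λ k → sum (map child (interval m k))) (candidates-count m s))
    where
    child : ℕ → ℕ
    child v = #tails (m + suc s + ascBit l v) (suc m ⊔ v) v r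

  mutual
    count-jumps : ∀ r a M l p k → a ≡ p + k → M ≤ suc (suc p) → l ≤ suc p →
      sum (map (λ v → #tails (a + ascBit l v) (M ⊔ v) v r) (interval (suc (suc p)) k)) ≡ sumTop r k
    count-jumps r a M l p zero    _     _   _   = refl
    count-jumps r a M l p (suc k) a≡ M≤ l≤ =
      trans (cong₂ _+_ first rest) (+-comm (countTop r (suc k)) (sumTop r k))
      where
      v : ℕ
      v = suc (suc p)
      a′≡ : a + ascBit l v ≡ suc p + suc k
      a′≡ = trans (cong (a +_) (ascBit-< (s≤s l≤))) (trans (+-comm a 1) (cong suc a≡))
      first : #tails (a + ascBit l v) (M ⊔ v) v r ≡ countTop r (suc k)
      first = trans (cong₂ (λ a′ M′ → #tails a′ M′ v r) a′≡ (m≤n⇒m⊔n≡n M≤)) (count-top r (suc p) k)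
      rest : sum (map (λ w → #tails (a + ascBit l w) (M ⊔ w) w r) (interval (suc v) k)) ≡ sumTop r k
      rest = count-jumps r a M l (suc p) k (trans a≡ (+-suc p k)) (m≤n⇒m≤1+n M≤) (m≤n⇒m≤1+n l≤)

    count-top : ∀ r m s → #tails (m + suc s) (suc m) (suc m) r ≡ countTop r (suc s)
    count-top zero    m s = refl
    count-top (suc r) m s = begin
      #tails a (suc m) (suc m) (suc r)
        ≡⟨ #tails-step m s (suc m) r ⟩
      F m + (F (suc m) + sum (map F (interval (suc (suc m)) (suc s))))
        ≡⟨ cong₂ _+_ down (cong₂ _+_ stay (count-jumps r a (suc m) (suc m) m (suc s) refl (n≤1+n _) ≤-refl)) ⟩
      countBelow r (suc s) + (countTop r (suc s) + sumTop r (suc s))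
        ≡⟨ +-assoc (countBelow r (suc s)) _ _ ⟨
      countTop (suc r) (suc s) ∎
      where
      a : ℕ
      a = m + suc s
      F : ℕ → ℕ
      F v = #tails (a + ascBit (suc m) v) (suc m ⊔ v) v r
      down : F m ≡ countBelow r (suc s)
      down = trans (cong₂ (λ a′ M′ → #tails a′ M′ m r) (no-ascent a (n≤1+n m)) (m≥n⇒m⊔n≡m (n≤1+n m)))
                   (count-below r m s)
      stay : F (suc m) ≡ countTop r (suc s)
      stay = trans (cong₂ (λ a′ M′ → #tails a′ M′ (suc m) r) (no-ascent a (≤-refl {suc m})) (⊔-idem (suc m)))
                   (count-top r m s)

    count-below : ∀ r m s → #tails (m + suc s) (suc m) m r ≡ countBelow r (suc s)
    count-below zero    m s = refl
    count-below (suc r) m s = begin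
      #tails a (suc m) m (suc r)
        ≡⟨ #tails-step m s m r ⟩
      F m + (F (suc m) + sum (map F (interval (suc (suc m)) (suc s))))
        ≡⟨ cong₂ _+_ stay (cong₂ _+_ up (count-jumps r a (suc m) m m (suc s) refl (n≤1+n _) (n≤1+n m))) ⟩
      countBelow r (suc s) + (countTop r (suc (suc s)) + sumTop r (suc s))
        ≡⟨ cong (countBelow r (suc s) +_) (+-comm (countTop r (suc (suc s))) (sumTop r (suc s))) ⟩
      countBelow (suc r) (suc s) ∎
      where
      a : ℕ
      a = m + suc s
      F : ℕ → ℕ
      F v = #tails (a + ascBit m v) (suc m ⊔ v) v r
      stay : F m ≡ countBelow r (suc s)
      stay = trans (cong₂ (λ a′ M′ → #tails a′ M′ m r) (no-ascent a (≤-refl {m})) (m≥n⇒m⊔n≡m (n≤1+n m)))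
                   (count-below r m s)
      -- v = M is an ascent over M - 1 and raises the slack by one
      up : F (suc m) ≡ countTop r (suc (suc s))
      up = trans (cong₂ (λ a′ M′ → #tails a′ M′ (suc m) r) a′≡ (⊔-idem (suc m))) (count-top r m (suc s))
        where
        a′≡ : a + ascBit m (suc m) ≡ m + suc (suc s)
        a′≡ = trans (cong (a +_) (ascBit-< (≤-refl {suc m}))) (trans (+-comm a 1) (sym (+-suc m (suc s))))

  -- From the initial state (after the leading 0) the candidates are 0 and 1.
  count-initial : ∀ r → #tails 0 0 0 r ≡ countBelow r 0
  count-initial zero    = refl
  count-initial (suc r) = trans (prefixEach-length (candidates 0 0) (λ v → restrictedTails (ascBit 0 v) v v r))
    (cong₂ _+_ (count-initial r) (trans (+-identityʳ _) (count-top r 0 0)))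

module Positions where

  open Tails
  open import Data.Nat
  open import Data.Nat.Properties
  open import Data.Unit using (tt)
  open import Data.Empty using (⊥-elim)
  open import Data.Sum using (inj₁; inj₂)
  open import Data.Product using (_×_; _,_; proj₁; proj₂; Σ)
  open import Data.List using (List; []; _∷_; _++_; length; lookup; take)
  open import Data.List.Properties using (++-assoc; ++-identityʳ)
  open import Data.Fin using (Fin; toℕ) renaming (zero to fzero; suc to fsuc)
  open import Relation.Nullary using (yes; no)
  open import Relation.Binary.PropositionalEquality

  lastOf : ℕ → List ℕ → ℕ
  lastOf y []      = y
  lastOf y (z ∷ q) = lastOf z q

  asc-snoc : ∀ y q x → asc (y ∷ q ++ x ∷ []) ≡ asc (y ∷ q) + ascBit (lastOf y q) x
  asc-snoc y []      x = +-identityʳ (ascBit y x)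
  asc-snoc y (z ∷ q) x = trans (cong (ascBit y z +_) (asc-snoc z q x)) (sym (+-assoc (ascBit y z) _ _))

  maxL-snoc : ∀ p x → maxL (p ++ x ∷ []) ≡ maxL p ⊔ x
  maxL-snoc []      x = ⊔-identityʳ x
  maxL-snoc (z ∷ p) x = trans (cong (z ⊔_) (maxL-snoc p x)) (sym (⊔-assoc z (maxL p) x))

  lastOf-snoc : ∀ y q x → lastOf y (q ++ x ∷ []) ≡ x
  lastOf-snoc y []      x = refl
  lastOf-snoc y (z ∷ q) x = lastOf-snoc z q x

  tail-snoc : ∀ P y q x xs →
    Tail P (asc (y ∷ q ++ x ∷ [])) (maxL (y ∷ q ++ x ∷ [])) (lastOf y (q ++ x ∷ [])) xs ≡
    Tail P (asc (y ∷ q) + ascBit (lastOf y q) x) (maxL (y ∷ q) ⊔ x) x xs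
  tail-snoc P y q x xs rewrite asc-snoc y q x | maxL-snoc (y ∷ q) x | lastOf-snoc y q x = refl

  EntryCond : (ℕ → ℕ → Set) → List ℕ → ℕ → Set
  EntryCond P p v = v ≤ suc (asc p) × P (maxL p) v

  positions⇒tail : ∀ P y q xs →
    ((i : Fin (length xs)) → EntryCond P (y ∷ q ++ take (toℕ i) xs) (lookup xs i)) →
    Tail P (asc (y ∷ q)) (maxL (y ∷ q)) (lastOf y q) xs
  positions⇒tail P y q []       _ = tt
  positions⇒tail P y q (x ∷ xs) H = proj₂ here , proj₁ here ,
    subst (λ T → T) (tail-snoc P y q x xs) (positions⇒tail P y (q ++ x ∷ []) xs later)
    where
    here : EntryCond P (y ∷ q) x
    here = subst (λ p → EntryCond P p x) (++-identityʳ (y ∷ q)) (H fzero)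
    later : (i : Fin (length xs)) → EntryCond P (y ∷ (q ++ x ∷ []) ++ take (toℕ i) xs) (lookup xs i)
    later i = subst (λ p → EntryCond P p (lookup xs i))
      (sym (++-assoc (y ∷ q) (x ∷ []) (take (toℕ i) xs))) (H (fsuc i))

  tail⇒positions : ∀ P y q xs → Tail P (asc (y ∷ q)) (maxL (y ∷ q)) (lastOf y q) xs →
    (i : Fin (length xs)) → EntryCond P (y ∷ q ++ take (toℕ i) xs) (lookup xs i)
  tail⇒positions P y q (x ∷ xs) (x-ok , x≤ , _) fzero =
    subst (λ p → EntryCond P p x) (sym (++-identityʳ (y ∷ q))) (x≤ , x-ok)
  tail⇒positions P y q (x ∷ xs) (_ , _ , xs-ok) (fsuc i) =
    subst (λ p → EntryCond P p (lookup xs i)) (++-assoc (y ∷ q) (x ∷ []) (take (toℕ i) xs))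
      (tail⇒positions P y (q ++ x ∷ []) xs (subst (λ T → T) (sym (tail-snoc P y q x xs)) xs-ok) i)

  lookup≤maxL : ∀ xs (j : Fin (length xs)) k → toℕ j < k → lookup xs j ≤ maxL (take k xs)
  lookup≤maxL (x ∷ xs) fzero    (suc k) _         = m≤m⊔n x _
  lookup≤maxL (x ∷ xs) (fsuc j) (suc k) (s≤s j<k) = ≤-trans (lookup≤maxL xs j k j<k) (m≤n⊔m x _)

  <⊔-skip : ∀ {v x m} → v < x ⊔ m → x ≤ v → v < m
  <⊔-skip v<x⊔m x≤v = ≰⇒> (λ m≤v → <⇒≱ v<x⊔m (⊔-lub x≤v m≤v))

  below-maxL : ∀ xs k v → v < maxL (take k xs) → Σ (Fin (length xs)) λ j → toℕ j < k × v < lookup xs j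
  below-maxL (x ∷ xs) (suc k) v v<max with v <? x
  ... | yes v<x = fzero , s≤s z≤n , v<x
  ... | no  v≮x with below-maxL xs k v (<⊔-skip v<max (≮⇒≥ v≮x))
  ...   | j , j<k , v<xⱼ = fsuc j , s≤s j<k , v<xⱼ

  ZeroOrRecord : List ℕ → Set
  ZeroOrRecord xs = (k : Fin (length xs)) → AStep (maxL (take (toℕ k) xs)) (lookup xs k)

  zeroOrRecord⇒avoids021 : ∀ xs → ZeroOrRecord xs → Avoids021 xs
  zeroOrRecord⇒avoids021 xs H i j k i<j j<k (xᵢ<xₖ , xₖ<xⱼ) with H k
  ... | inj₁ xₖ≡0   = <⇒≱ xᵢ<xₖ (subst (_≤ lookup xs i) (sym xₖ≡0) z≤n)
  ... | inj₂ max≤xₖ = <⇒≱ xₖ<xⱼ (≤-trans (lookup≤maxL xs j (toℕ k) j<k) max≤xₖ)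

  -- Conversely, with a leading 0, an entry 0 < v below an earlier entry w completes 0 w v.
  avoids021⇒zeroOrRecord : ∀ xs → Avoids021 (0 ∷ xs) → ZeroOrRecord (0 ∷ xs)
  avoids021⇒zeroOrRecord xs avoid k with lookup (0 ∷ xs) k ≟ 0
  ... | yes v≡0 = inj₁ v≡0
  ... | no  v≢0 with maxL (take (toℕ k) (0 ∷ xs)) ≤? lookup (0 ∷ xs) k
  ...   | yes max≤v = inj₂ max≤v
  ...   | no  max≰v with below-maxL (0 ∷ xs) (toℕ k) _ (≰⇒> max≰v)
  ...     | fzero  , _   , ()
  ...     | fsuc j , j<k , v<w = ⊥-elim (avoid fzero (fsuc j) k (s≤s z≤n) j<k (n≢0⇒n>0 v≢0 , v<w))

open import Data.Nat using (zero; suc; z≤n; s≤s; _∸_)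
open import Data.Nat.Properties using (suc-injective)
open import Data.Product using (_,_; proj₁; proj₂; ∃-syntax)
open import Data.Sum using (inj₁)
open import Data.List using ([]; _∷_; map; lookup; take)
open import Data.List.Properties using (length-map; map-∘; map-id-local)
open import Data.List.Membership.Propositional.Properties using (∈-map⁺; ∈-map⁻)
import Data.List.Relation.Unary.All as All
import Data.List.Relation.Unary.Unique.Propositional.Properties as Unique
open import Data.Fin using (Fin; toℕ) renaming (zero to fzero; suc to fsuc)
open import Function.Bundles using (mk⇔)
open import Relation.Binary.PropositionalEquality using (refl; sym; trans; cong; subst)

open Ballot
open TreeCounts
open Tails
open Bijection
open Enumeration
open Positions

unique-map : ∀ {A B : Set} (f : A → B) (g : B → A) xs →
  (∀ {x} → x ∈ xs → g (f x) ≡ x) → Unique xs → Unique (map f xs)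
unique-map f g xs left xs! = Unique.map⁻ (subst Unique (sym map-gf) xs!)
  where
  map-gf : map g (map f xs) ≡ xs
  map-gf = trans (sym (map-∘ xs)) (map-id-local (All.tabulate left))

R⇒tail : ∀ m x → R (suc m) x → ∃[ xs ] x ≡ 0 ∷ xs × length xs ≡ m × Tail RStep 0 0 0 xs
R⇒tail m []        (() , _)
R⇒tail m (x₀ ∷ xs) (len , (first , bound) , restricted) with first fzero refl
... | refl = xs , refl , suc-injective len ,
  positions⇒tail RStep 0 [] xs (λ i → bound (fsuc i) (s≤s z≤n) , restricted (fsuc i) (s≤s z≤n))

tail⇒R : ∀ m xs → length xs ≡ m → Tail RStep 0 0 0 xs → R (suc m) (0 ∷ xs)
tail⇒R m xs len xs-ok = cong suc len , (first , bound) , restricted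
  where
  H : (i : Fin (length xs)) → EntryCond RStep (0 ∷ take (toℕ i) xs) (lookup xs i)
  H = tail⇒positions RStep 0 [] xs xs-ok
  first : (i : Fin (suc (length xs))) → toℕ i ≡ 0 → lookup (0 ∷ xs) i ≡ 0
  first fzero    _ = refl
  first (fsuc i) ()
  bound : (i : Fin (suc (length xs))) → 1 ≤ toℕ i → lookup (0 ∷ xs) i ≤ suc (asc (take (toℕ i) (0 ∷ xs)))
  bound (fsuc i) _ = proj₁ (H i)
  restricted : (i : Fin (suc (length xs))) → 1 ≤ toℕ i →
    maxL (take (toℕ i) (0 ∷ xs)) ∸ 1 ≤ lookup (0 ∷ xs) i
  restricted (fsuc i) _ = proj₂ (H i)

A⇒tail : ∀ m y → A (suc m) y → ∃[ ys ] y ≡ 0 ∷ ys × length ys ≡ m × Tail AStep 0 0 0 ys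
A⇒tail m []        (() , _)
A⇒tail m (y₀ ∷ ys) (len , (first , bound) , avoid) with first fzero refl
... | refl = ys , refl , suc-injective len ,
  positions⇒tail AStep 0 [] ys (λ i → bound (fsuc i) (s≤s z≤n) , record-or-zero (fsuc i))
  where
  record-or-zero : ZeroOrRecord (0 ∷ ys)
  record-or-zero = avoids021⇒zeroOrRecord ys avoid

tail⇒A : ∀ m ys → length ys ≡ m → Tail AStep 0 0 0 ys → A (suc m) (0 ∷ ys)
tail⇒A m ys len ys-ok = cong suc len , (first , bound) , zeroOrRecord⇒avoids021 (0 ∷ ys) record-or-zero
  where
  H : (i : Fin (length ys)) → EntryCond AStep (0 ∷ take (toℕ i) ys) (lookup ys i)
  H = tail⇒positions AStep 0 [] ys ys-ok
  first : (i : Fin (suc (length ys))) → toℕ i ≡ 0 → lookup (0 ∷ ys) i ≡ 0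
  first fzero    _ = refl
  first (fsuc i) ()
  bound : (i : Fin (suc (length ys))) → 1 ≤ toℕ i → lookup (0 ∷ ys) i ≤ suc (asc (take (toℕ i) (0 ∷ ys)))
  bound (fsuc i) _ = proj₁ (H i)
  record-or-zero : ZeroOrRecord (0 ∷ ys)
  record-or-zero fzero    = inj₁ refl
  record-or-zero (fsuc i) = proj₂ (H i)

Φ Ψ : List ℕ → List ℕ
Φ = forward 0
Ψ = backward 0

initial : LastRel 0 0 0
initial = last-same z≤n

Φ-R⇒A : ∀ m x → R (suc m) x → A (suc m) (Φ x)
Φ-R⇒A m x x-ok with R⇒tail m x x-ok
... | xs , refl , len , xs-ok =
  tail⇒A m (forward 0 xs) (trans (forward-length 0 xs) len) (forward-tail xs initial xs-ok)

Ψ-A⇒R : ∀ m y → A (suc m) y → R (suc m) (Ψ y)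
Ψ-A⇒R m y y-ok with A⇒tail m y y-ok
... | ys , refl , len , ys-ok =
  tail⇒R m (backward 0 ys) (trans (backward-length 0 ys) len) (backward-tail ys initial z≤n ys-ok)

Ψ∘Φ : ∀ m x → R (suc m) x → Ψ (Φ x) ≡ x
Ψ∘Φ m x x-ok with R⇒tail m x x-ok
... | xs , refl , _ , xs-ok = cong (0 ∷_) (backward-forward xs xs-ok)

Φ∘Ψ : ∀ m y → A (suc m) y → Φ (Ψ y) ≡ y
Φ∘Ψ m y y-ok with A⇒tail m y y-ok
... | ys , refl , _ , ys-ok = cong (0 ∷_) (forward-backward ys ys-ok)

Φ-asc : ∀ m x → R (suc m) x → asc (Φ x) ≡ asc x
Φ-asc m x x-ok with R⇒tail m x x-ok
... | xs , refl , _ , xs-ok = forward-asc xs initial xs-ok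

restrictedSeqs : ℕ → List (List ℕ)
restrictedSeqs m = map (0 ∷_) (restrictedTails 0 0 0 m)

∈-restrictedSeqs⁺ : ∀ m x → R (suc m) x → x ∈ restrictedSeqs m
∈-restrictedSeqs⁺ m x x-ok with R⇒tail m x x-ok
... | xs , refl , len , xs-ok = ∈-map⁺ (0 ∷_) (∈-restrictedTails⁺ 0 0 0 m xs len xs-ok)

∈-restrictedSeqs⁻ : ∀ m x → x ∈ restrictedSeqs m → R (suc m) x
∈-restrictedSeqs⁻ m x x∈ with ∈-map⁻ (0 ∷_) x∈
... | xs , xs∈ , refl with ∈-restrictedTails⁻ 0 0 0 m xs xs∈
...   | len , xs-ok = tail⇒R m xs len xs-ok

restrictedSeqs-unique : ∀ m → Unique (restrictedSeqs m)
restrictedSeqs-unique m = Unique.map⁺ ∷-injectiveʳ (restrictedTails-unique 0 0 0 m)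
  where
  ∷-injectiveʳ : ∀ {xs ys : List ℕ} → 0 ∷ xs ≡ 0 ∷ ys → xs ≡ ys
  ∷-injectiveʳ refl = refl

restrictedSeqs-length : ∀ m → length (restrictedSeqs m) ≡ catalan (suc m)
restrictedSeqs-length m = trans (length-map (0 ∷_) (restrictedTails 0 0 0 m))
  (trans (count-initial m) (trans (countBelow-ballot m) (ballot-catalan m)))

avoidingSeqs : ℕ → List (List ℕ)
avoidingSeqs m = map Φ (restrictedSeqs m)

∈-avoidingSeqs : ∀ m y → (y ∈ avoidingSeqs m) ⇔ A (suc m) y
∈-avoidingSeqs m y = mk⇔ to from
  where
  to : y ∈ avoidingSeqs m → A (suc m) y
  to y∈ with ∈-map⁻ Φ y∈
  ... | x , x∈ , refl = Φ-R⇒A m x (∈-restrictedSeqs⁻ m x x∈)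
  from : A (suc m) y → y ∈ avoidingSeqs m
  from y-ok = subst (_∈ avoidingSeqs m) (Φ∘Ψ m y y-ok)
    (∈-map⁺ Φ (∈-restrictedSeqs⁺ m (Ψ y) (Ψ-A⇒R m y y-ok)))

avoidingSeqs-unique : ∀ m → Unique (avoidingSeqs m)
avoidingSeqs-unique m = unique-map Φ Ψ (restrictedSeqs m)
  (λ {x} x∈ → Ψ∘Φ m x (∈-restrictedSeqs⁻ m x x∈)) (restrictedSeqs-unique m)

avoidingSeqs-length : ∀ m → length (avoidingSeqs m) ≡ catalan (suc m)
avoidingSeqs-length m = trans (length-map Φ (restrictedSeqs m)) (restrictedSeqs-length m)

theorem2p11 : (n : ℕ) → 1 ≤ n →
    (Σ (List ℕ → List ℕ) λ f →
        ((x : List ℕ) → R n x → A n (f x)) ×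
        ((x y : List ℕ) → R n x → R n y → f x ≡ f y → x ≡ y) ×
        ((y : List ℕ) → A n y → ∃ λ x → R n x × f x ≡ y) ×
        ((x : List ℕ) → R n x → asc (f x) ≡ asc x)) ×
    (Σ (List (List ℕ)) λ L →
        Unique L × ((x : List ℕ) → (x ∈ L) ⇔ A n x) × length L ≡ catalan n)
theorem2p11 zero    ()
theorem2p11 (suc m) _ =
  (Φ , Φ-R⇒A m , injective , surjective , Φ-asc m) ,
  (avoidingSeqs m , avoidingSeqs-unique m , ∈-avoidingSeqs m , avoidingSeqs-length m)
  where
  injective : (x y : List ℕ) → R (suc m) x → R (suc m) y → Φ x ≡ Φ y → x ≡ y
  injective x y x-ok y-ok Φx≡Φy =
    trans (sym (Ψ∘Φ m x x-ok)) (trans (cong Ψ Φx≡Φy) (Ψ∘Φ m y y-ok))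
  surjective : (y : List ℕ) → A (suc m) y → ∃ λ x → R (suc m) x × Φ x ≡ y
  surjective y y-ok = Ψ y , Ψ-A⇒R m y y-ok , Φ∘Ψ m y y-ok
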